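{- Let $H$ be a 3-connected graph and let $\mathcal{T}$ be a tangle of order at least 4 in $H$. Then the elements of $\mathcal{D}^{\mathrm{pre}\triangle}(H,\mathcal{T})$ are pairwise disjoint and pairwise nonadjacent (no edge of $H$ joins two distinct elements), and for every $D\in\mathcal{D}^{\mathrm{pre}\triangle}(H,\mathcal{T})$ the separation $(N_H[D],V(H)\setminus D)$ is of order exactly 3 in $H$.
   Context: A separation of $H$ is a pair $(A,B)$ with $A\cup B=V(H)$ and no edge between $A\setminus B$ and $B\setminus A$; its order is $|A\cap B|$. A tangle of order $k$ in $H$ is a set $\mathcal{T}$ of separations of order less than $k$ such that for every separation $(A,B)$ of order less than $k$, $(A,B)\in\mathcal{T}$ or $(B,A)\in\mathcal{T}$, and no three members $(A_i,B_i)$ satisfy $A_1\cup A_2\cup A_3=V(H)$. A $\mathcal{T}$-predongle is a set $D\subseteq V(H)$ with $|N_H(D)|\le 3$ and $(N_H[D],V(H)\setminus D)\in\mathcal{T}$. Let $\mathcal{D}^{\mathrm{pre}\triangle}_0(H,\mathcal{T})$ be the family of inclusion-wise maximal $\mathcal{T}$-predongles, and $\mathcal{D}^{\mathrm{pre}\triangle}(H,\mathcal{T})=\{D\setminus\bigcup_{D'\in\mathcal{D}^{\mathrm{pre}\triangle}_0(H,\mathcal{T})\setminus\{D\}}N_H[D'] : D\in\mathcal{D}^{\mathrm{pre}\triangle}_0(H,\mathcal{T})\}\setminus\{\emptyset\}$. -}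

module Defs where

open import Data.Nat using (ℕ; zero; suc; _<_; _≤_)
open import Data.Bool using (Bool; true; false; _∧_; _∨_; not)
open import Data.Fin using (Fin) renaming (zero to fzero; suc to fsuc)
open import Data.Fin.Subset using (Subset; _∈_; _∉_; _⊆_; ∁; _∩_; _∪_; ⊤; ∣_∣; Nonempty)
open import Data.Vec using (Vec; tabulate; lookup)
open import Data.Product using (Σ; ∃; _×_; _,_)
open import Data.Sum using (_⊎_)
open import Data.Empty using (⊥)
open import Relation.Binary.PropositionalEquality using (_≡_; _≢_)
open import Relation.Nullary using (¬_)

record Graph : Set where
  field
    n      : ℕ
    adj    : Fin n → Fin n → Bool
    sym    : ∀ u v → adj u v ≡ adj v u
    irrefl : ∀ v → adj v v ≡ false
open Graph public

anyFin : ∀ {m} → (Fin m → Bool) → Bool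
anyFin {zero}  f = false
anyFin {suc m} f = f fzero ∨ anyFin (λ i → f (fsuc i))

module _ (H : Graph) where

  V : Set
  V = Fin (n H)

  VSet : Set
  VSet = Subset (n H)

  data Reach (X : VSet) (u : V) : V → Set where
    here : u ∉ X → Reach X u u
    step : ∀ {v w} → Reach X u v → w ∉ X → adj H v w ≡ true → Reach X u w

  KConnected : ℕ → Set
  KConnected k = k < n H ×
    (∀ (X : VSet) → ∣ X ∣ < k → ∀ u v → u ∉ X → v ∉ X → Reach X u v)

  N : VSet → VSet
  N D = tabulate (λ v → not (lookup D v) ∧ anyFin (λ u → lookup D u ∧ adj H u v))

  N[_] : VSet → VSet
  N[ D ] = D ∪ N D

  IsSeparation : VSet → VSet → Set
  IsSeparation A B = (A ∪ B ≡ ⊤) ×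
    (∀ u v → u ∈ A → u ∉ B → v ∈ B → v ∉ A → adj H u v ≡ false)

  order : VSet → VSet → ℕ
  order A B = ∣ A ∩ B ∣

  IsTangle : ℕ → (VSet → VSet → Set) → Set
  IsTangle k 𝒯 =
    (∀ A B → 𝒯 A B → IsSeparation A B × order A B < k) ×
    (∀ A B → IsSeparation A B → order A B < k → 𝒯 A B ⊎ 𝒯 B A) ×
    (∀ A₁ B₁ A₂ B₂ A₃ B₃ → 𝒯 A₁ B₁ → 𝒯 A₂ B₂ → 𝒯 A₃ B₃ →
       ¬ (A₁ ∪ A₂ ∪ A₃ ≡ ⊤))

  module _ (𝒯 : VSet → VSet → Set) where

    IsPredongle : VSet → Set
    IsPredongle D = ∣ N D ∣ ≤ 3 × 𝒯 N[ D ] (∁ D)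

    -- Members of D^{pre△}_0: inclusion-wise maximal predongles.
    IsMaxPredongle : VSet → Set
    IsMaxPredongle D = IsPredongle D ×
      (∀ D' → IsPredongle D' → D ⊆ D' → D' ≡ D)

    -- Members of D^{pre△}: X = D ∖ ⋃_{D' ∈ D0 ∖ {D}} N[D'] for some D ∈ D0,
    -- with X nonempty.
    IsPreDongleTri : VSet → Set
    IsPreDongleTri X = Σ VSet λ D → IsMaxPredongle D ×
      (∀ v → (v ∈ X → v ∈ D × ¬ (Σ VSet λ D' → IsMaxPredongle D' × D' ≢ D × v ∈ N[ D' ]))
           × (v ∈ D → ¬ (Σ VSet λ D' → IsMaxPredongle D' × D' ≢ D × v ∈ N[ D' ]) → v ∈ X))
      × Nonempty X

module Submission where

-- Two distinct maximal predongles D, D′ cannot satisfy |N(D ∪ D′)| ≤ 3: the separation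
-- (N[D ∪ D′], V ∖ (D ∪ D′)) then has order < 4 ≤ k, so either it lies in the tangle and D ∪ D′
-- is a predongle containing both, or its reverse does and covers V together with the separations
-- of D and D′. Submodularity of |N(·)| and 3-connectivity (|N(C)| ≥ 3 whenever C ≠ ∅ and
-- N[C] ≠ V) then make maximal predongles disjoint, and give every w ∈ D ∩ N[D′] a private
-- neighbour, i.e. a vertex outside D whose only neighbour in D is w. Deleting such vertices from D
-- one at a time never increases |N(·)|, so the core X of D has 3 ≤ |N(X)| ≤ |N(D)| ≤ 3. Distinct
-- cores are disjoint and nonadjacent because the core of D′ avoids N[D].

open import Defs hiding (sym)
open import Data.Nat using (ℕ; suc; _+_; _≤_; _<_; _≤?_; s≤s)
open import Data.Nat.Properties
  using (+-suc; +-identityʳ; +-mono-≤; +-monoʳ-≤; +-cancelʳ-≤; ≤-trans; ≤-reflexive; ≤-antisym;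
         <-≤-trans; ≰⇒>; module ≤-Reasoning)
open import Data.Nat.Induction using (<-wellFounded)
open import Induction.WellFounded using (Acc; acc)
open import Data.Bool using (Bool; true; false; _∧_; not) renaming (_≟_ to _≟ᵇ_)
open import Data.Fin using (Fin; zero) renaming (suc to fsuc)
open import Data.Fin.Properties using (any?; all?) renaming (_≟_ to _≟ᶠ_)
open import Data.Fin.Subset
  using (Subset; inside; outside; _∈_; _∉_; _⊆_; ∁; _∩_; _∪_; _─_; _-_; ⊤; ⁅_⁆; ∣_∣; Empty)
open import Data.Fin.Subset.Properties
  using (_∈?_; nonempty?; Empty-unique; ∣⊥∣≡0; ⊆⊤; x∈⁅x⁆; x∈⁅y⁆⇒x≡y; ∣⁅x⁆∣≡1; ⊆-antisym; p⊆q⇒∣p∣≤∣q∣;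
         x∈∁p⇒x∉p; x∉∁p⇒x∈p; x∉p⇒x∈∁p; p∩q⊆p; x∈p∩q⁺; x∈p∩q⁻; p⊆p∪q; q⊆p∪q; x∈p∪q⁻; x∈p∪q⁺;
         x∈p∧x∉q⇒x∈p─q; p─q⊆p; x∈p∧x≢y⇒x∈p-y; x∈p⇒∣p-x∣<∣p∣)
open import Data.Vec using ([]; _∷_; lookup; here; there)
open import Data.Vec.Properties using (lookup∘tabulate; lookup⇒[]=; []=⇒lookup)
open import Data.Product using (Σ; ∃; _×_; _,_; proj₁; proj₂)
open import Data.Sum using (inj₁; inj₂; [_,_]′)
open import Data.Empty using (⊥; ⊥-elim)
open import Function using (_∘_)
open import Relation.Nullary using (¬_; Dec; yes; no)
open import Relation.Nullary.Decidable using (¬?; _×-dec_; _→-dec_; decidable-stable)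
open import Relation.Binary.PropositionalEquality
  using (_≡_; _≢_; refl; sym; trans; cong; subst; subst₂; module ≡-Reasoning)

∣p∪q∣+∣p∩q∣≡∣p∣+∣q∣ : ∀ {m} (p q : Subset m) → ∣ p ∪ q ∣ + ∣ p ∩ q ∣ ≡ ∣ p ∣ + ∣ q ∣
∣p∪q∣+∣p∩q∣≡∣p∣+∣q∣ []            []            = refl
∣p∪q∣+∣p∩q∣≡∣p∣+∣q∣ (outside ∷ p) (outside ∷ q) = ∣p∪q∣+∣p∩q∣≡∣p∣+∣q∣ p q
∣p∪q∣+∣p∩q∣≡∣p∣+∣q∣ (inside ∷ p)  (outside ∷ q) = cong suc (∣p∪q∣+∣p∩q∣≡∣p∣+∣q∣ p q)
∣p∪q∣+∣p∩q∣≡∣p∣+∣q∣ (outside ∷ p) (inside ∷ q)  =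
  trans (cong suc (∣p∪q∣+∣p∩q∣≡∣p∣+∣q∣ p q)) (sym (+-suc ∣ p ∣ ∣ q ∣))
∣p∪q∣+∣p∩q∣≡∣p∣+∣q∣ (inside ∷ p)  (inside ∷ q)  = cong suc (begin
  ∣ p ∪ q ∣ + suc ∣ p ∩ q ∣  ≡⟨ +-suc ∣ p ∪ q ∣ ∣ p ∩ q ∣ ⟩
  suc (∣ p ∪ q ∣ + ∣ p ∩ q ∣) ≡⟨ cong suc (∣p∪q∣+∣p∩q∣≡∣p∣+∣q∣ p q) ⟩
  suc (∣ p ∣ + ∣ q ∣)         ≡⟨ sym (+-suc ∣ p ∣ ∣ q ∣) ⟩
  ∣ p ∣ + suc ∣ q ∣           ∎)
  where open ≡-Reasoning

∣p∪q∣≡∣p∣+∣q∣ : ∀ {m} (p q : Subset m) → Empty (p ∩ q) → ∣ p ∪ q ∣ ≡ ∣ p ∣ + ∣ q ∣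
∣p∪q∣≡∣p∣+∣q∣ {m} p q disjoint = begin
  ∣ p ∪ q ∣                 ≡⟨ sym (+-identityʳ ∣ p ∪ q ∣) ⟩
  ∣ p ∪ q ∣ + 0             ≡⟨ cong (∣ p ∪ q ∣ +_) (sym ∣p∩q∣≡0) ⟩
  ∣ p ∪ q ∣ + ∣ p ∩ q ∣     ≡⟨ ∣p∪q∣+∣p∩q∣≡∣p∣+∣q∣ p q ⟩
  ∣ p ∣ + ∣ q ∣             ∎
  where
  open ≡-Reasoning
  ∣p∩q∣≡0 : ∣ p ∩ q ∣ ≡ 0
  ∣p∩q∣≡0 = trans (cong ∣_∣ (Empty-unique disjoint)) (∣⊥∣≡0 m)

∣⁅x⁆∪p∣≡1+∣p∣ : ∀ {m} {x : Fin m} {p} → x ∉ p → ∣ ⁅ x ⁆ ∪ p ∣ ≡ suc ∣ p ∣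
∣⁅x⁆∪p∣≡1+∣p∣ {x = x} {p} x∉p =
  trans (∣p∪q∣≡∣p∣+∣q∣ ⁅ x ⁆ p disjoint) (cong (_+ ∣ p ∣) (∣⁅x⁆∣≡1 x))
  where
  disjoint : Empty (⁅ x ⁆ ∩ p)
  disjoint (y , y∈⁅x⁆∩p) with x∈p∩q⁻ ⁅ x ⁆ p y∈⁅x⁆∩p
  ... | y∈⁅x⁆ , y∈p = x∉p (subst (_∈ p) (x∈⁅y⁆⇒x≡y x y∈⁅x⁆) y∈p)

∣⁅x⁆∪⁅y⁆∪⁅z⁆∣≡3 : ∀ {m} {x y z : Fin m} → x ≢ y → x ≢ z → y ≢ z → ∣ ⁅ x ⁆ ∪ ⁅ y ⁆ ∪ ⁅ z ⁆ ∣ ≡ 3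
∣⁅x⁆∪⁅y⁆∪⁅z⁆∣≡3 {x = x} {y} {z} x≢y x≢z y≢z = begin
  ∣ ⁅ x ⁆ ∪ ⁅ y ⁆ ∪ ⁅ z ⁆ ∣   ≡⟨ ∣⁅x⁆∪p∣≡1+∣p∣ x∉⁅y⁆∪⁅z⁆ ⟩
  suc ∣ ⁅ y ⁆ ∪ ⁅ z ⁆ ∣       ≡⟨ cong suc (∣⁅x⁆∪p∣≡1+∣p∣ (y≢z ∘ x∈⁅y⁆⇒x≡y z)) ⟩
  suc (suc ∣ ⁅ z ⁆ ∣)         ≡⟨ cong (suc ∘ suc) (∣⁅x⁆∣≡1 z) ⟩
  3                           ∎
  where
  open ≡-Reasoning
  x∉⁅y⁆∪⁅z⁆ : x ∉ ⁅ y ⁆ ∪ ⁅ z ⁆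
  x∉⁅y⁆∪⁅z⁆ x∈ = [ x≢y ∘ x∈⁅y⁆⇒x≡y y , x≢z ∘ x∈⁅y⁆⇒x≡y z ]′ (x∈p∪q⁻ ⁅ y ⁆ ⁅ z ⁆ x∈)

∣p∣+∣q∣≤∣r∣+∣s∣ : ∀ {m} {p q r s : Subset m} → p ∪ q ⊆ r ∪ s → p ∩ q ⊆ r ∩ s →
                  ∣ p ∣ + ∣ q ∣ ≤ ∣ r ∣ + ∣ s ∣
∣p∣+∣q∣≤∣r∣+∣s∣ {p = p} {q} {r} {s} ∪⊆ ∩⊆ = begin
  ∣ p ∣ + ∣ q ∣             ≡⟨ sym (∣p∪q∣+∣p∩q∣≡∣p∣+∣q∣ p q) ⟩
  ∣ p ∪ q ∣ + ∣ p ∩ q ∣     ≤⟨ +-mono-≤ (p⊆q⇒∣p∣≤∣q∣ ∪⊆) (p⊆q⇒∣p∣≤∣q∣ ∩⊆) ⟩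
  ∣ r ∪ s ∣ + ∣ r ∩ s ∣     ≡⟨ ∣p∪q∣+∣p∩q∣≡∣p∣+∣q∣ r s ⟩
  ∣ r ∣ + ∣ s ∣             ∎
  where open ≤-Reasoning

x∈p─q⇒x∉q : ∀ {m} {x : Fin m} (p q : Subset m) → x ∈ p ─ q → x ∉ q
x∈p─q⇒x∉q (_ ∷ p) (inside ∷ q)  ()               here
x∈p─q⇒x∉q (_ ∷ p) (_ ∷ q)       (there x∈p─q)    (there x∈q) = x∈p─q⇒x∉q p q x∈p─q x∈q

x∈p-y⇒x≢y : ∀ {m} {x y : Fin m} {p} → x ∈ p - y → x ≢ y
x∈p-y⇒x≢y {y = y} {p} x∈p-y refl = x∈p─q⇒x∉q p ⁅ y ⁆ x∈p-y (x∈⁅x⁆ y)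

∪-⊆ : ∀ {m} {p q r : Subset m} → p ⊆ r → q ⊆ r → p ∪ q ⊆ r
∪-⊆ {p = p} {q} p⊆r q⊆r x∈p∪q = [ p⊆r , q⊆r ]′ (x∈p∪q⁻ p q x∈p∪q)

⁅x⁆⊆ : ∀ {m} {x : Fin m} {p} → x ∈ p → ⁅ x ⁆ ⊆ p
⁅x⁆⊆ {x = x} {p} x∈p y∈⁅x⁆ = subst (_∈ p) (sym (x∈⁅y⁆⇒x≡y x y∈⁅x⁆)) x∈p

⁅x⁆∪⁅y⁆⊆ : ∀ {m} {x y : Fin m} {p} → x ∈ p → y ∈ p → ⁅ x ⁆ ∪ ⁅ y ⁆ ⊆ p
⁅x⁆∪⁅y⁆⊆ x∈p y∈p = ∪-⊆ (⁅x⁆⊆ x∈p) (⁅x⁆⊆ y∈p)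

⊤⊆⇒≡⊤ : ∀ {m} {p : Subset m} → ⊤ ⊆ p → p ≡ ⊤
⊤⊆⇒≡⊤ ⊤⊆p = ⊆-antisym ⊆⊤ ⊤⊆p

lookup≡false⇒∉ : ∀ {m} {x : Fin m} {p} → lookup p x ≡ false → x ∉ p
lookup≡false⇒∉ eq x∈p with trans (sym ([]=⇒lookup x∈p)) eq
... | ()

∉⇒lookup≡false : ∀ {m} {x : Fin m} {p} → x ∉ p → lookup p x ≡ false
∉⇒lookup≡false {x = x} {p} x∉p with lookup p x in eq
... | true  = ⊥-elim (x∉p (lookup⇒[]= x p eq))
... | false = refl

∧-true⁻ : ∀ {a b} → a ∧ b ≡ true → a ≡ true × b ≡ true
∧-true⁻ {true} {true} refl = refl , refl

not-true⁻ : ∀ {a} → not a ≡ true → a ≡ false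
not-true⁻ {false} refl = refl

anyFin⁺ : ∀ {m} (f : Fin m → Bool) i → f i ≡ true → anyFin f ≡ true
anyFin⁺ f zero     fi rewrite fi = refl
anyFin⁺ f (fsuc i) fi with f zero
... | true  = refl
... | false = anyFin⁺ (f ∘ fsuc) i fi

anyFin⁻ : ∀ {m} (f : Fin m → Bool) → anyFin f ≡ true → ∃ λ i → f i ≡ true
anyFin⁻ {suc m} f any with f zero in f0
... | true  = zero , f0
... | false with anyFin⁻ (f ∘ fsuc) any
... | i , fi = fsuc i , fi

module _ (H : Graph) where

  ∈N⁺ : ∀ {D u v} → v ∉ D → u ∈ D → adj H u v ≡ true → v ∈ N H D
  ∈N⁺ {D} {u} {v} v∉D u∈D uv = lookup⇒[]= v (N H D) (begin
    lookup (N H D) v                ≡⟨ lookup∘tabulate _ v ⟩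
    not (lookup D v) ∧ D-neighbour  ≡⟨ cong (λ b → not b ∧ D-neighbour) (∉⇒lookup≡false v∉D) ⟩
    D-neighbour                     ≡⟨ anyFin⁺ _ u (trans (cong (_∧ adj H u v) ([]=⇒lookup u∈D)) uv) ⟩
    true                            ∎)
    where
    open ≡-Reasoning
    D-neighbour : Bool
    D-neighbour = anyFin (λ x → lookup D x ∧ adj H x v)

  ∈N⁻ : ∀ {D v} → v ∈ N H D → v ∉ D × ∃ λ u → u ∈ D × adj H u v ≡ true
  ∈N⁻ {D} {v} v∈ND with ∧-true⁻ (trans (sym (lookup∘tabulate _ v)) ([]=⇒lookup v∈ND))
  ... | v∉D , some with anyFin⁻ _ some
  ... | u , u∈D∧uv with ∧-true⁻ u∈D∧uv
  ... | u∈D , adj-uv = lookup≡false⇒∉ (not-true⁻ v∉D) , u , lookup⇒[]= u D u∈D , adj-uv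

  ⊆N[] : ∀ {D} → D ⊆ N[_] H D
  ⊆N[] = x∈p∪q⁺ ∘ inj₁

  N⊆N[] : ∀ {D} → N H D ⊆ N[_] H D
  N⊆N[] = x∈p∪q⁺ ∘ inj₂

  adj⇒∈N[] : ∀ {D u v} → u ∈ D → adj H u v ≡ true → v ∈ N[_] H D
  adj⇒∈N[] {D} {v = v} u∈D uv with v ∈? D
  ... | yes v∈D = ⊆N[] v∈D
  ... | no  v∉D = N⊆N[] (∈N⁺ v∉D u∈D uv)

  N[]-mono : ∀ {C D} → C ⊆ D → N[_] H C ⊆ N[_] H D
  N[]-mono {C} C⊆D x∈N[C] with x∈p∪q⁻ C (N H C) x∈N[C]
  ... | inj₁ x∈C = ⊆N[] (C⊆D x∈C)
  ... | inj₂ x∈NC with ∈N⁻ x∈NC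
  ...   | _ , u , u∈C , ux = adj⇒∈N[] (C⊆D u∈C) ux

  N[]-isSeparation : ∀ C → IsSeparation H (N[_] H C) (∁ C)
  N[]-isSeparation C = ⊤⊆⇒≡⊤ cover , noEdge
    where
    cover : ⊤ ⊆ N[_] H C ∪ ∁ C
    cover {x} _ with x ∈? C
    ... | yes x∈C = x∈p∪q⁺ (inj₁ (⊆N[] x∈C))
    ... | no  x∉C = x∈p∪q⁺ (inj₂ (x∉p⇒x∈∁p x∉C))
    noEdge : ∀ u v → u ∈ N[_] H C → u ∉ ∁ C → v ∈ ∁ C → v ∉ N[_] H C → adj H u v ≡ false
    noEdge u v _ u∉∁C _ v∉N[C] with adj H u v in uv
    ... | false = refl
    ... | true  = ⊥-elim (v∉N[C] (adj⇒∈N[] (x∉∁p⇒x∈p u∉∁C) uv))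

  order-N[] : ∀ C → order H (N[_] H C) (∁ C) ≡ ∣ N H C ∣
  order-N[] C = cong ∣_∣ (⊆-antisym boundary⊆N N⊆boundary)
    where
    N⊆boundary : N H C ⊆ N[_] H C ∩ ∁ C
    N⊆boundary x∈NC = x∈p∩q⁺ (N⊆N[] x∈NC , x∉p⇒x∈∁p (proj₁ (∈N⁻ x∈NC)))
    boundary⊆N : N[_] H C ∩ ∁ C ⊆ N H C
    boundary⊆N x∈ with x∈p∩q⁻ _ _ x∈
    ... | x∈N[C] , x∈∁C with x∈p∪q⁻ C (N H C) x∈N[C]
    ...   | inj₁ x∈C  = ⊥-elim (x∈∁p⇒x∉p x∈∁C x∈C)
    ...   | inj₂ x∈NC = x∈NC

  N-∪⊆ : ∀ C D → N H (C ∪ D) ⊆ N H C ∪ N H D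
  N-∪⊆ C D x∈ with ∈N⁻ x∈
  ... | x∉C∪D , u , u∈C∪D , ux with x∈p∪q⁻ C D u∈C∪D
  ...   | inj₁ u∈C = x∈p∪q⁺ (inj₁ (∈N⁺ (x∉C∪D ∘ p⊆p∪q D) u∈C ux))
  ...   | inj₂ u∈D = x∈p∪q⁺ (inj₂ (∈N⁺ (x∉C∪D ∘ q⊆p∪q C D) u∈D ux))

  N-∩⊆ : ∀ C D → N H (C ∩ D) ⊆ N H C ∪ N H D
  N-∩⊆ C D {x} x∈ with ∈N⁻ x∈ | x ∈? C
  ... | x∉C∩D , u , u∈C∩D , ux | yes x∈C =
    x∈p∪q⁺ (inj₂ (∈N⁺ (λ x∈D → x∉C∩D (x∈p∩q⁺ (x∈C , x∈D))) (proj₂ (x∈p∩q⁻ C D u∈C∩D)) ux))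
  ... | _ , u , u∈C∩D , ux | no x∉C =
    x∈p∪q⁺ (inj₁ (∈N⁺ x∉C (proj₁ (x∈p∩q⁻ C D u∈C∩D)) ux))

  N-submodular : ∀ C D → ∣ N H (C ∪ D) ∣ + ∣ N H (C ∩ D) ∣ ≤ ∣ N H C ∣ + ∣ N H D ∣
  N-submodular C D = ∣p∣+∣q∣≤∣r∣+∣s∣ (∪-⊆ (N-∪⊆ C D) (N-∩⊆ C D)) shared
    where
    shared : N H (C ∪ D) ∩ N H (C ∩ D) ⊆ N H C ∩ N H D
    shared x∈ with x∈p∩q⁻ _ _ x∈
    ... | x∈N∪ , x∈N∩ with ∈N⁻ x∈N∪ | ∈N⁻ x∈N∩
    ...   | x∉C∪D , _ | _ , u , u∈C∩D , ux with x∈p∩q⁻ C D u∈C∩D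
    ...     | u∈C , u∈D = x∈p∩q⁺ (∈N⁺ (x∉C∪D ∘ p⊆p∪q D) u∈C ux , ∈N⁺ (x∉C∪D ∘ q⊆p∪q C D) u∈D ux)

  N-∪+≤ : ∀ C D {Q} → Q ⊆ C ∪ D → Q ⊆ N H C ∪ N H D →
          ∣ N H (C ∪ D) ∣ + ∣ Q ∣ ≤ ∣ N H C ∣ + ∣ N H D ∣
  N-∪+≤ C D Q⊆C∪D Q⊆N∪N = ∣p∣+∣q∣≤∣r∣+∣s∣ (∪-⊆ (N-∪⊆ C D) Q⊆N∪N) shared
    where
    shared : N H (C ∪ D) ∩ _ ⊆ N H C ∩ N H D
    shared x∈ with x∈p∩q⁻ _ _ x∈
    ... | x∈N∪ , x∈Q = ⊥-elim (proj₁ (∈N⁻ x∈N∪) (Q⊆C∪D x∈Q))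

  Reach-N-stays : ∀ {C u v} → u ∈ C → Reach H (N H C) u v → v ∈ C
  Reach-N-stays u∈C (here _) = u∈C
  Reach-N-stays {C} {v = x} u∈C (step walk x∉NC yx) with x ∈? C
  ... | yes x∈C = x∈C
  ... | no  x∉C = ⊥-elim (x∉NC (∈N⁺ x∉C (Reach-N-stays u∈C walk) yx))

  KConnected⇒≤∣N∣ : ∀ {k C u v} → KConnected H k → u ∈ C → v ∉ N[_] H C → k ≤ ∣ N H C ∣
  KConnected⇒≤∣N∣ {k} {C} (_ , connected) u∈C v∉N[C] with k ≤? ∣ N H C ∣
  ... | yes k≤∣NC∣ = k≤∣NC∣
  ... | no  k≰∣NC∣ = ⊥-elim (v∉N[C] (⊆N[] (Reach-N-stays u∈C walk)))
    where
    walk : Reach H (N H C) _ _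
    walk = connected (N H C) (≰⇒> k≰∣NC∣) _ _ (λ u∈NC → proj₁ (∈N⁻ u∈NC) u∈C) (v∉N[C] ∘ N⊆N[])

  PrivateNeighbour : VSet H → V H → Set
  PrivateNeighbour D w =
    ∃ λ u → u ∉ D × adj H w u ≡ true × (∀ w′ → w′ ∈ D → adj H w′ u ≡ true → w′ ≡ w)

  privateNeighbour? : ∀ D w → Dec (PrivateNeighbour D w)
  privateNeighbour? D w = any? λ u →
    ¬? (u ∈? D) ×-dec (adj H w u ≟ᵇ true) ×-dec
    all? (λ w′ → (w′ ∈? D) →-dec ((adj H w′ u ≟ᵇ true) →-dec (w′ ≟ᶠ w)))

  PrivateNeighbour-⊆ : ∀ {C D w} → C ⊆ D → PrivateNeighbour D w → PrivateNeighbour C w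
  PrivateNeighbour-⊆ C⊆D (u , u∉D , wu , only-w) = u , u∉D ∘ C⊆D , wu , λ w′ → only-w w′ ∘ C⊆D

  -- The private neighbour leaves the boundary, which pays for w possibly entering it.
  ∣N∣-remove-≤ : ∀ {D w} → w ∈ D → PrivateNeighbour D w → ∣ N H (D - w) ∣ ≤ ∣ N H D ∣
  ∣N∣-remove-≤ {D} {w} w∈D (u , u∉D , wu , only-w) =
    +-cancelʳ-≤ 1 _ _ (subst₂ (λ a b → ∣ N H (D - w) ∣ + a ≤ ∣ N H D ∣ + b) (∣⁅x⁆∣≡1 u) (∣⁅x⁆∣≡1 w)
      (∣p∣+∣q∣≤∣r∣+∣s∣ (∪-⊆ N-remove⊆ (⁅x⁆⊆ (x∈p∪q⁺ (inj₁ (∈N⁺ u∉D w∈D wu))))) shared))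
    where
    N-remove⊆ : N H (D - w) ⊆ N H D ∪ ⁅ w ⁆
    N-remove⊆ {x} x∈ with ∈N⁻ x∈ | x ≟ᶠ w
    ... | _ | yes refl = x∈p∪q⁺ (inj₂ (x∈⁅x⁆ w))
    ... | x∉D-w , y , y∈D-w , yx | no x≢w =
      x∈p∪q⁺ (inj₁ (∈N⁺ (λ x∈D → x∉D-w (x∈p∧x≢y⇒x∈p-y x∈D x≢w)) (p─q⊆p D ⁅ w ⁆ y∈D-w) yx))
    shared : N H (D - w) ∩ ⁅ u ⁆ ⊆ N H D ∩ ⁅ w ⁆
    shared x∈ with x∈p∩q⁻ _ _ x∈
    ... | x∈N , x∈⁅u⁆ with x∈⁅y⁆⇒x≡y u x∈⁅u⁆
    ...   | refl with ∈N⁻ x∈N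
    ...     | _ , y , y∈D-w , yu = ⊥-elim (x∈p-y⇒x≢y y∈D-w (only-w y (p─q⊆p D ⁅ w ⁆ y∈D-w) yu))

  ∣N∣-shrink-≤ : ∀ {X D} → X ⊆ D → (∀ {w} → w ∈ D → w ∉ X → PrivateNeighbour D w) → ∣ N H X ∣ ≤ ∣ N H D ∣
  ∣N∣-shrink-≤ {X} {D} = go D (<-wellFounded ∣ D ∣)
    where
    go : ∀ D → Acc _<_ ∣ D ∣ → X ⊆ D → (∀ {w} → w ∈ D → w ∉ X → PrivateNeighbour D w) →
         ∣ N H X ∣ ≤ ∣ N H D ∣
    go D (acc smaller) X⊆D private-nbr with nonempty? (D ─ X)
    ... | no D─X-empty = ≤-reflexive (cong (∣_∣ ∘ N H) (⊆-antisym X⊆D D⊆X))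
      where
      D⊆X : D ⊆ X
      D⊆X {x} x∈D = decidable-stable (x ∈? X) λ x∉X → D─X-empty (x , x∈p∧x∉q⇒x∈p─q x∈D x∉X)
    ... | yes (w , w∈D─X) = ≤-trans
      (go (D - w) (smaller (x∈p⇒∣p-x∣<∣p∣ w∈D)) X⊆D-w
          (λ w′∈D-w w′∉X → PrivateNeighbour-⊆ (p─q⊆p D ⁅ w ⁆) (private-nbr (p─q⊆p D ⁅ w ⁆ w′∈D-w) w′∉X)))
      (∣N∣-remove-≤ w∈D (private-nbr w∈D w∉X))
      where
      w∈D : w ∈ D
      w∈D = p─q⊆p D X w∈D─X
      w∉X : w ∉ X
      w∉X = x∈p─q⇒x∉q D X w∈D─X
      X⊆D-w : X ⊆ D - w
      X⊆D-w x∈X = x∈p∧x≢y⇒x∈p-y (X⊆D x∈X) λ { refl → w∉X x∈X }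

module _ (H : Graph) (𝒯 : VSet H → VSet H → Set) where

  CoveredByOther : VSet H → V H → Set
  CoveredByOther D v = Σ (VSet H) λ D′ → IsMaxPredongle H 𝒯 D′ × D′ ≢ D × v ∈ N[_] H D′

  IsCore : VSet H → VSet H → Set
  IsCore X D = ∀ v → (v ∈ X → v ∈ D × ¬ CoveredByOther D v) × (v ∈ D → ¬ CoveredByOther D v → v ∈ X)

  IsCore-⊆ : ∀ {X D} → IsCore X D → X ⊆ D
  IsCore-⊆ core {v} v∈X = proj₁ (proj₁ (core v) v∈X)

  IsCore-unique : ∀ {X Y D} → IsCore X D → IsCore Y D → X ≡ Y
  IsCore-unique coreX coreY = ⊆-antisym (core⊆core coreX coreY) (core⊆core coreY coreX)
    where
    core⊆core : ∀ {X Y D} → IsCore X D → IsCore Y D → X ⊆ Y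
    core⊆core coreX coreY {v} v∈X with proj₁ (coreX v) v∈X
    ... | v∈D , uncovered = proj₂ (coreY v) v∈D uncovered

  IsCore-∉N[] : ∀ {Y D D′ v} → IsCore Y D → IsMaxPredongle H 𝒯 D′ → D′ ≢ D → v ∈ Y → v ∉ N[_] H D′
  IsCore-∉N[] coreY maxD′ D′≢D v∈Y v∈N[D′] = proj₂ (proj₁ (coreY _) v∈Y) (_ , maxD′ , D′≢D , v∈N[D′])

  preDongleTris-separated : ∀ {X Y} → IsPreDongleTri H 𝒯 X → IsPreDongleTri H 𝒯 Y → X ≢ Y →
    (∀ v → v ∈ X → v ∈ Y → ⊥) × (∀ u v → u ∈ X → v ∈ Y → adj H u v ≡ false)
  preDongleTris-separated {X} {Y} (D , maxD , coreX , _) (D′ , _ , coreY , _) X≢Y = disjoint , nonadjacent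
    where
    D≢D′ : D ≢ D′
    D≢D′ refl = X≢Y (IsCore-unique coreX coreY)
    Y-avoids-N[D] : ∀ {v} → v ∈ Y → v ∉ N[_] H D
    Y-avoids-N[D] = IsCore-∉N[] coreY maxD D≢D′
    disjoint : ∀ v → v ∈ X → v ∈ Y → ⊥
    disjoint v v∈X v∈Y = Y-avoids-N[D] v∈Y (⊆N[] H (IsCore-⊆ coreX v∈X))
    nonadjacent : ∀ u v → u ∈ X → v ∈ Y → adj H u v ≡ false
    nonadjacent u v u∈X v∈Y with adj H u v in uv
    ... | false = refl
    ... | true  = ⊥-elim (Y-avoids-N[D] v∈Y (adj⇒∈N[] H (IsCore-⊆ coreX u∈X) uv))

module _ (H : Graph) {k : ℕ} (𝒯 : VSet H → VSet H → Set) (tangle : IsTangle H k 𝒯) where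

  private
    IsMax : VSet H → Set
    IsMax = IsMaxPredongle H 𝒯

  tangle-smallSide-proper : ∀ {A B} → 𝒯 A B → ∃ λ v → v ∉ A
  tangle-smallSide-proper {A} {B} t with nonempty? (∁ A)
  ... | yes (v , v∈∁A) = v , x∈∁p⇒x∉p v∈∁A
  ... | no  ∁A-empty   = ⊥-elim (proj₂ (proj₂ tangle) A B A B A B t t t (⊤⊆⇒≡⊤ λ _ →
    x∈p∪q⁺ (inj₁ (x∉∁p⇒x∈p λ x∈∁A → ∁A-empty (_ , x∈∁A)))))

  maxPredongles-≡ : ∀ {D D′} → 4 ≤ k → IsMax D → IsMax D′ →
                    ∣ N H (D ∪ D′) ∣ + 3 ≤ ∣ N H D ∣ + ∣ N H D′ ∣ → D ≡ D′
  maxPredongles-≡ {D} {D′} 4≤k ((∣ND∣≤3 , t) , maxD) ((∣ND′∣≤3 , t′) , maxD′) excess =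
    ∣N∪∣≤3⇒≡ (+-cancelʳ-≤ 3 _ 3 (≤-trans excess (+-mono-≤ ∣ND∣≤3 ∣ND′∣≤3)))
    where
    cover : ⊤ ⊆ N[_] H D ∪ N[_] H D′ ∪ ∁ (D ∪ D′)
    cover {x} _ with x ∈? D | x ∈? D′
    ... | yes x∈D | _        = x∈p∪q⁺ (inj₁ (⊆N[] H x∈D))
    ... | no  _   | yes x∈D′ = x∈p∪q⁺ (inj₂ (x∈p∪q⁺ (inj₁ (⊆N[] H x∈D′))))
    ... | no  x∉D | no x∉D′  =
      x∈p∪q⁺ (inj₂ (x∈p∪q⁺ (inj₂ (x∉p⇒x∈∁p λ x∈D∪D′ → [ x∉D , x∉D′ ]′ (x∈p∪q⁻ D D′ x∈D∪D′)))))
    ∣N∪∣≤3⇒≡ : ∣ N H (D ∪ D′) ∣ ≤ 3 → D ≡ D′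
    ∣N∪∣≤3⇒≡ ∣N∪∣≤3
      with proj₁ (proj₂ tangle) (N[_] H (D ∪ D′)) (∁ (D ∪ D′)) (N[]-isSeparation H (D ∪ D′))
             (<-≤-trans (s≤s (≤-trans (≤-reflexive (order-N[] H (D ∪ D′))) ∣N∪∣≤3)) 4≤k)
    ... | inj₁ t∪ = trans (sym (maxD (D ∪ D′) (∣N∪∣≤3 , t∪) (p⊆p∪q D′)))
                          (maxD′ (D ∪ D′) (∣N∪∣≤3 , t∪) (q⊆p∪q D D′))
    ... | inj₂ t∪ = ⊥-elim (proj₂ (proj₂ tangle) _ _ _ _ _ _ t t′ t∪ (⊤⊆⇒≡⊤ cover))

  maxPredongles-disjoint : ∀ {D D′ w} → KConnected H 3 → 4 ≤ k → IsMax D → IsMax D′ → D ≢ D′ →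
                           w ∈ D → w ∉ D′
  maxPredongles-disjoint {D} {D′} conn 4≤k maxD maxD′ D≢D′ w∈D w∈D′ =
    D≢D′ (maxPredongles-≡ 4≤k maxD maxD′ (≤-trans (+-monoʳ-≤ _ 3≤∣N∩∣) (N-submodular H D D′)))
    where
    outside-N[D] : ∃ λ v → v ∉ N[_] H D
    outside-N[D] = tangle-smallSide-proper (proj₂ (proj₁ maxD))
    3≤∣N∩∣ : 3 ≤ ∣ N H (D ∩ D′) ∣
    3≤∣N∩∣ = KConnected⇒≤∣N∣ H conn (x∈p∩q⁺ (w∈D , w∈D′))
               (proj₂ outside-N[D] ∘ N[]-mono H (p∩q⊆p D D′))

  maxPredongle-privateNeighbour : ∀ {D D′ w} → KConnected H 3 → 4 ≤ k → IsMax D → IsMax D′ → D′ ≢ D →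
                                  w ∈ D → w ∈ N[_] H D′ → PrivateNeighbour H D w
  maxPredongle-privateNeighbour {D} {D′} {w} conn 4≤k maxD maxD′ D′≢D w∈D w∈N[D′]
    with x∈p∪q⁻ D′ (N H D′) w∈N[D′]
  ... | inj₁ w∈D′ = ⊥-elim (maxPredongles-disjoint conn 4≤k maxD maxD′ (D′≢D ∘ sym) w∈D w∈D′)
  ... | inj₂ w∈ND′ with ∈N⁻ H w∈ND′
  ...   | _ , u , u∈D′ , uw = u , u∉D , wu , only-w
    where
    disjoint : ∀ {x} → x ∈ D → x ∉ D′
    disjoint = maxPredongles-disjoint conn 4≤k maxD maxD′ (D′≢D ∘ sym)
    u∉D : u ∉ D
    u∉D u∈D = disjoint u∈D u∈D′
    wu : adj H w u ≡ true
    wu = trans (Graph.sym H w u) uw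
    only-w : ∀ w′ → w′ ∈ D → adj H w′ u ≡ true → w′ ≡ w
    only-w w′ w′∈D w′u with w′ ≟ᶠ w
    ... | yes w′≡w = w′≡w
    ... | no  w′≢w = ⊥-elim (D′≢D (sym (maxPredongles-≡ 4≤k maxD maxD′ excess)))
      where
      excess : ∣ N H (D ∪ D′) ∣ + 3 ≤ ∣ N H D ∣ + ∣ N H D′ ∣
      excess = subst (λ m → ∣ N H (D ∪ D′) ∣ + m ≤ ∣ N H D ∣ + ∣ N H D′ ∣)
        (∣⁅x⁆∪⁅y⁆∪⁅z⁆∣≡3 {x = u} (λ { refl → u∉D w∈D }) (λ { refl → u∉D w′∈D }) (w′≢w ∘ sym))
        (N-∪+≤ H D D′
          (∪-⊆ (⁅x⁆⊆ (q⊆p∪q D D′ u∈D′)) (⁅x⁆∪⁅y⁆⊆ (p⊆p∪q D′ w∈D) (p⊆p∪q D′ w′∈D)))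
          (∪-⊆ (⁅x⁆⊆ (x∈p∪q⁺ (inj₁ (∈N⁺ H u∉D w∈D wu))))
               (⁅x⁆∪⁅y⁆⊆ (x∈p∪q⁺ (inj₂ w∈ND′))
                         (x∈p∪q⁺ (inj₂ (∈N⁺ H (disjoint w′∈D) u∈D′ (trans (Graph.sym H u w′) w′u)))))))

  preDongleTri-∣N∣≡3 : ∀ {X} → KConnected H 3 → 4 ≤ k → IsPreDongleTri H 𝒯 X → ∣ N H X ∣ ≡ 3
  preDongleTri-∣N∣≡3 {X} conn 4≤k (D , maxD , core , (u , u∈X)) = ≤-antisym upper lower
    where
    X⊆D : X ⊆ D
    X⊆D = IsCore-⊆ H 𝒯 core
    -- CoveredByOther is not decidable, but PrivateNeighbour is, so it can be obtained by contraposition.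
    private-nbr : ∀ {w} → w ∈ D → w ∉ X → PrivateNeighbour H D w
    private-nbr {w} w∈D w∉X = decidable-stable (privateNeighbour? H D w) λ none →
      w∉X (proj₂ (core w) w∈D λ (D′ , maxD′ , D′≢D , w∈N[D′]) →
        none (maxPredongle-privateNeighbour conn 4≤k maxD maxD′ D′≢D w∈D w∈N[D′]))
    upper : ∣ N H X ∣ ≤ 3
    upper = ≤-trans (∣N∣-shrink-≤ H X⊆D private-nbr) (proj₁ (proj₁ maxD))
    lower : 3 ≤ ∣ N H X ∣
    lower = KConnected⇒≤∣N∣ H conn u∈X
              (proj₂ (tangle-smallSide-proper (proj₂ (proj₁ maxD))) ∘ N[]-mono H X⊆D)

lemma6p8 : (H : Graph) → KConnected H 3 →
    (k : ℕ) → 4 ≤ k → (𝒯 : VSet H → VSet H → Set) → IsTangle H k 𝒯 →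
    (∀ X Y → IsPreDongleTri H 𝒯 X → IsPreDongleTri H 𝒯 Y → X ≢ Y →
       (∀ v → v ∈ X → v ∈ Y → ⊥) × (∀ u v → u ∈ X → v ∈ Y → adj H u v ≡ false))
    × (∀ D → IsPreDongleTri H 𝒯 D →
       IsSeparation H (N[_] H D) (∁ D) × order H (N[_] H D) (∁ D) ≡ 3)
lemma6p8 H conn k 4≤k 𝒯 tangle =
  (λ X Y → preDongleTris-separated H 𝒯) ,
  λ D preDongleTri → N[]-isSeparation H D ,
    trans (order-N[] H D) (preDongleTri-∣N∣≡3 H 𝒯 tangle conn 4≤k preDongleTri)
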